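{- Let $a=(a_k)_{k\ge1}$ and $b=(b_k)_{k\ge1}$ be sequences of complex numbers with $a_1=b_1=0$. Then for all integers $r,s\ge1$, $$P_{(r,s);a}=\sum_{r'=1}^r\sum_{s'=1}^s d_{rr'}(a,b)\,d_{ss'}(a,b)\,P_{(r',s');b}.$$
   Context: Put $(x\mid c)^k=\prod_{m=1}^k(x-c_m)$ for a sequence $c$. For a strict partition $\lambda=(\lambda_1>\dots>\lambda_l>0)$ and $m\ge l$, $$P_{\lambda;c}(x_1,\dots,x_m)=\frac1{(m-l)!}\sum_{\omega\in S(m)}\prod_{i=1}^l (x_{\omega(i)}\mid c)^{\lambda_i}\prod_{1\le i\le l,\ i<j\le m}\frac{x_{\omega(i)}+x_{\omega(j)}}{x_{\omega(i)}-x_{\omega(j)}},$$ and $0$ if $m<l$, defining an element $P_{\lambda;c}$ of the algebra $\Gamma$ of supersymmetric functions (stable sequences of supersymmetric polynomials). For integers $k>l\ge0$, $P_{(k,l);c}$ is the function of the strict partition $(k,l)$, and for $0\le k\le l$ one puts $P_{(k,l);c}=-P_{(l,k);c}$. Super complete homogeneous functions: $\sum_{k\ge0}h_k(y_1,\dots,y_p;z_1,\dots,z_q)t^k=\prod_{m=1}^q(1+z_mt)\big/\prod_{m=1}^p(1-y_mt)$. For integers $r\ge r'\ge0$ put $d_{rr'}(a,b)=h_{r-r'}(b_2,\dots,b_{r'+1};-a_2,\dots,-a_r)$, and $d_{rr'}(a,b)=0$ if $r<r'$. -}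

module Defs where

open import Level using (Level; _⊔_) renaming (suc to lsuc)
open import Algebra.Bundles using (CommutativeRing)
open import Data.Nat as ℕ using (ℕ; zero; suc; _∸_; _<?_)
open import Data.Nat.Base using (_!)
open import Data.Maybe using (fromMaybe)
open import Data.Bool using (_∧_)
open import Data.Fin as Fin using (Fin; toℕ)
open import Data.Fin.Properties using (all?)
open import Data.List as List using (List; []; _∷_)
open import Relation.Nullary using (¬_; Dec; yes; no; does)
open import Relation.Nullary.Decidable using (_→-dec_)
open import Relation.Binary.PropositionalEquality using (_≡_)
open import Data.Bool using (if_then_else_)

-- Fields of characteristic zero (the paper works over ℂ).
-- The inverse is total; it is only constrained on nonzero elements.

natCast : ∀ {c ℓ} (R : CommutativeRing c ℓ) → ℕ → CommutativeRing.Carrier R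
natCast R zero    = CommutativeRing.0# R
natCast R (suc n) = CommutativeRing._+_ R (CommutativeRing.1# R) (natCast R n)

record CharZeroField (c ℓ : Level) : Set (lsuc (c ⊔ ℓ)) where
  field
    commRing : CommutativeRing c ℓ
  open CommutativeRing commRing public
  field
    _⁻¹     : Carrier → Carrier
    inverse : ∀ x → ¬ (x ≈ 0#) → x * (x ⁻¹) ≈ 1#

    char0 : ∀ n → natCast commRing n ≈ 0# → n ≡ 0

allFuns : (n k : ℕ) → List (Fin n → Fin k)
allFuns zero    k = (λ ()) ∷ []
allFuns (suc n) k =
  List.concatMap (λ f → List.map (λ j → extend j f) (List.allFin k)) (allFuns n k)
  where
  extend : ∀ {n k} → Fin k → (Fin n → Fin k) → Fin (suc n) → Fin k
  extend j f Fin.zero    = j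
  extend j f (Fin.suc i) = f i

Injective? : ∀ {m} (ω : Fin m → Fin m) → Dec (∀ i j → ω i ≡ ω j → i ≡ j)
Injective? ω = all? (λ i → all? (λ j → (ω i Fin.≟ ω j) →-dec (i Fin.≟ j)))

Sym : (m : ℕ) → List (Fin m → Fin m)
Sym m = List.filter Injective? (allFuns m m)

module _ {c ℓ : Level} (F : CharZeroField c ℓ) where
  open CharZeroField F

  sumL : List Carrier → Carrier
  sumL = List.foldr _+_ 0#

  sumFin : (n : ℕ) → (Fin n → Carrier) → Carrier
  sumFin zero    f = 0#
  sumFin (suc n) f = f Fin.zero + sumFin n (λ i → f (Fin.suc i))

  prodFin : (n : ℕ) → (Fin n → Carrier) → Carrier
  prodFin zero    f = 1#
  prodFin (suc n) f = f Fin.zero * prodFin n (λ i → f (Fin.suc i))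

  sum1 : ℕ → (ℕ → Carrier) → Carrier
  sum1 n f = sumFin n (λ i → f (suc (toℕ i)))

  prod1 : ℕ → (ℕ → Carrier) → Carrier
  prod1 n f = prodFin n (λ i → f (suc (toℕ i)))

  -- Sequences c = (c_k)_{k ≥ 1} are functions ℕ → Carrier; the value at 0 is unused.
  -- (x | c)^k = Π_{m=1}^k (x - c_m)
  fpow : Carrier → (ℕ → Carrier) → ℕ → Carrier
  fpow x c k = prod1 k (λ t → x - c t)

  -- P_{λ;c}(x_1,…,x_m) for a partition λ = (λ_1,…,λ_l) given as a list
  -- (index i of the paper is the 0-based Fin position here).
  P : (ℕ → Carrier) → List ℕ → (m : ℕ) → (Fin m → Carrier) → Carrier
  P c lam m x with m <? List.length lam
  ... | yes _ = 0#
  ... | no  _ =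
    (natCast commRing ((m ∸ l) !) ⁻¹) *
    sumL (List.map term (Sym m))
    where
    l : ℕ
    l = List.length lam
    part : ℕ → ℕ
    part i = fromMaybe 0 (List.head (List.drop i lam))
    term : (Fin m → Fin m) → Carrier
    term ω =
      prodFin m (λ i → if does (toℕ i <? l)
                        then fpow (x (ω i)) c (part (toℕ i))
                        else 1#)
      * prodFin m (λ i → prodFin m (λ j →
          if does (toℕ i <? l) ∧ does (toℕ i <? toℕ j)
          then (x (ω i) + x (ω j)) * ((x (ω i) - x (ω j)) ⁻¹)
          else 1#))

  strictPart : ℕ → ℕ → List ℕ
  strictPart k zero    = k ∷ []
  strictPart k (suc l) = k ∷ suc l ∷ []

  -- P_{(k,l);c} for arbitrary k, l ≥ 0 with the paper's conventions:
  -- k > l: the function of the strict partition (k,l) (which is (k) if l = 0);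
  -- k ≤ l: P_{(k,l);c} = - P_{(l,k);c}  (so P_{(k,k);c} = 0).
  P2 : (ℕ → Carrier) → ℕ → ℕ → (m : ℕ) → (Fin m → Carrier) → Carrier
  P2 c k l m x with l <? k | k <? l
  ... | yes _ | _     = P c (strictPart k l) m x
  ... | no _  | yes _ = - P c (strictPart l k) m x
  ... | no _  | no _  = 0#

  Series : Set c
  Series = ℕ → Carrier

  mulS : Series → Series → Series
  mulS f g k = sumFin (suc k) (λ i → f (toℕ i) * g (k ∸ toℕ i))

  oneS : Series
  oneS zero    = 1#
  oneS (suc _) = 0#

  -- 1 / (1 - y t) = Σ y^n t^n
  geomS : Carrier → Series
  geomS y zero    = 1#
  geomS y (suc n) = y * geomS y n

  linS : Carrier → Series
  linS z zero          = 1#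
  linS z (suc zero)    = z
  linS z (suc (suc _)) = 0#

  hSuper : List Carrier → List Carrier → ℕ → Carrier
  hSuper ys zs =
    mulS (List.foldr (λ z s → mulS (linS z) s) oneS zs)
         (List.foldr (λ y s → mulS (geomS y) s) oneS ys)

  d : ℕ → ℕ → (ℕ → Carrier) → (ℕ → Carrier) → Carrier
  d r r' a b with r <? r'
  ... | yes _ = 0#
  ... | no  _ =
    hSuper (List.map (λ i → b (2 ℕ.+ i)) (List.upTo r'))
           (List.map (λ i → - a (2 ℕ.+ i)) (List.upTo (r ∸ 1)))
           (r ∸ r')

{-# OPTIONS --safe #-}
-- In P_{(k,l);c} the sequence c and the parts k, l enter only through the factor
-- (x_{ω(1)} | c)^k (x_{ω(2)} | c)^l, so for distinct x_i it is a bilinear, antisymmetric function of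
-- the pair of one-variable functions ((· | c)^k, (· | c)^l); with 2 invertible, antisymmetry also makes
-- it vanish on equal arguments, which accounts for the conventions for k ≤ l.  The theorem thus reduces
-- to the one-variable change of base
--   (x | a)^r = Σ_{r′=1}^{r} d_{rr′}(a,b) (x | b)^{r′},
-- proved by induction on r from (x | a)^{r+1} = (x | a)^r (x − a_{r+1}), starting from a_1 = b_1, and
-- the recursion d_{r+1,j+1} = d_{r,j} + (b_{j+2} − a_{r+1}) d_{r,j+1}.  That recursion is the coefficient
-- form of multiplying the generating function Π (1 + z_m t) / Π (1 − y_m t) of h(y; z) by
-- (1 + z t) / (1 − y t), where multiplications by 1 + z t and by 1 / (1 − y t) all commute.

module Submission where

open import Defs
open import Data.Nat using (ℕ; _≤_)
open import Data.Fin using (Fin)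
open import Relation.Binary.PropositionalEquality using (_≡_)

open import Level using (Level; _⊔_)
open import Algebra.Bundles using (CommutativeRing)
open import Data.Bool using (true; false; if_then_else_; _∧_)
open import Data.Nat as ℕ using (zero; suc; _∸_; _<_; _<?_; z≤n; s≤s; _!)
import Data.Nat.Properties as ℕ
open import Data.Fin as Fin using (toℕ)
open import Data.Fin.Patterns using (0F; 1F)
import Data.Fin.Properties as Fin
open import Data.List as List using (List; []; _∷_; _++_; _∷ʳ_)
import Data.List.Properties as List
open import Data.Vec.Functional using (Vector) renaming (_∷_ to _◂_)
open import Function using (_∘_; _⇔_; mk⇔; Congruent; Equivalence)
open import Relation.Nullary using (¬_; Dec; yes; no; does; contradiction)
open import Data.Sum using (inj₁; inj₂)
open import Relation.Binary.PropositionalEquality as ≡ using (_≗_)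

map-upTo-suc : ∀ {a} {A : Set a} (f : ℕ → A) n →
               List.map f (List.upTo (suc n)) ≡ List.map f (List.upTo n) ∷ʳ f n
map-upTo-suc f n = ≡.trans (≡.cong (List.map f) (≡.sym (List.upTo-∷ʳ n)))
                           (List.map-++ f (List.upTo n) (n ∷ []))

IsInjective : ∀ {m k} → (Fin m → Fin k) → Set
IsInjective ω = ∀ i j → ω i ≡ ω j → i ≡ j

≗-injective : ∀ {m k} {ω ω′ : Fin m → Fin k} → ω ≗ ω′ → IsInjective ω → IsInjective ω′
≗-injective ω≗ω′ ω-inj i j eq = ω-inj i j (≡.trans (ω≗ω′ i) (≡.trans eq (≡.sym (ω≗ω′ j))))

∘-injective : ∀ {m k l} {ω : Fin k → Fin l} {σ : Fin m → Fin k} →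
              IsInjective ω → IsInjective σ → IsInjective (ω ∘ σ)
∘-injective ω-inj σ-inj i j eq = σ-inj i j (ω-inj _ _ eq)

swap01 : ∀ {n} → Fin (2 ℕ.+ n) → Fin (2 ℕ.+ n)
swap01 0F                    = 1F
swap01 1F                    = 0F
swap01 (Fin.suc (Fin.suc i)) = Fin.suc (Fin.suc i)

swap01-involutive : ∀ {n} (i : Fin (2 ℕ.+ n)) → swap01 (swap01 i) ≡ i
swap01-involutive 0F                    = ≡.refl
swap01-involutive 1F                    = ≡.refl
swap01-involutive (Fin.suc (Fin.suc i)) = ≡.refl

swap01-injective : ∀ {n} → IsInjective (swap01 {n})
swap01-injective i j eq =
  ≡.trans (≡.sym (swap01-involutive i)) (≡.trans (≡.cong swap01 eq) (swap01-involutive j))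

∘swap01-injective⇔ : ∀ {n k} (ω : Fin (2 ℕ.+ n) → Fin k) → IsInjective (ω ∘ swap01) ⇔ IsInjective ω
∘swap01-injective⇔ ω = mk⇔
  (λ ω∘swap-inj → ≗-injective (≡.cong ω ∘ swap01-involutive) (∘-injective ω∘swap-inj swap01-injective))
  (λ ω-inj → ∘-injective ω-inj swap01-injective)

module RingLemmas {c ℓ} (R : CommutativeRing c ℓ) where
  open CommutativeRing R hiding (zero)
  open import Algebra.Properties.Ring ring using (-0#≈0#)
  open import Algebra.Properties.AbelianGroup +-abelianGroup using (⁻¹-∙-comm)
  open import Algebra.Properties.Semiring.Sum semiring public
  open import Algebra.Solver.Ring.NaturalCoefficients.Default commutativeSemiring
    using (solve; _:=_; _:+_; _:*_)
  open import Relation.Binary.Reasoning.Setoid setoid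

  sub-telescope : ∀ x y z → x - z ≈ (x - y) + (y - z)
  sub-telescope x y z = begin
    x - z                   ≈⟨ +-congʳ (+-identityʳ x) ⟨
    (x + 0#) - z            ≈⟨ +-congʳ (+-congˡ (-‿inverseˡ y)) ⟨
    (x + (- y + y)) - z     ≈⟨ solve 4 (λ x y -y -z → (x :+ (-y :+ y)) :+ -z := (x :+ -y) :+ (y :+ -z))
                                refl x y (- y) (- z) ⟩
    (x - y) + (y - z)       ∎

  sum-zero : ∀ {n} {f : Vector Carrier n} → (∀ i → f i ≈ 0#) → sum f ≈ 0#
  sum-zero {n} f≈0 = trans (sum-cong-≋ f≈0) (sum-replicate-zero n)

  sum-*-sum : ∀ {m n} (f : Vector Carrier m) (g : Vector Carrier n) →
              sum f * sum g ≈ ∑[ i < m ] ∑[ j < n ] (f i * g j)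
  sum-*-sum f g = trans (*-distribʳ-sum (sum g) f)
                        (sum-cong-≋ (λ i → *-distribˡ-sum (f i) g))

  sumBelow : ℕ → (ℕ → Carrier) → Carrier
  sumBelow n g = ∑[ i < n ] g (toℕ i)

  sumBelow-cong : ∀ n {g h : ℕ → Carrier} → (∀ j → j < n → g j ≈ h j) → sumBelow n g ≈ sumBelow n h
  sumBelow-cong n g≈h = sum-cong-≋ {n} (λ i → g≈h (toℕ i) (Fin.toℕ<n i))

  sumBelow-distrib-+ : ∀ n (g h : ℕ → Carrier) → sumBelow n (λ j → g j + h j) ≈ sumBelow n g + sumBelow n h
  sumBelow-distrib-+ n g h = ∑-distrib-+ {n} (g ∘ toℕ) (h ∘ toℕ)

  *-distribˡ-sumBelow : ∀ n x (g : ℕ → Carrier) → x * sumBelow n g ≈ sumBelow n (λ j → x * g j)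
  *-distribˡ-sumBelow n x g = *-distribˡ-sum {n} x (g ∘ toℕ)

  *-distribʳ-sumBelow : ∀ n x (g : ℕ → Carrier) → sumBelow n g * x ≈ sumBelow n (λ j → g j * x)
  *-distribʳ-sumBelow n x g = *-distribʳ-sum {n} x (g ∘ toℕ)

  sumBelow-last : ∀ n (g : ℕ → Carrier) → sumBelow (suc n) g ≈ sumBelow n g + g n
  sumBelow-last n g = trans (sum-init-last (g ∘ toℕ))
    (+-cong (reflexive (sum-cong-≗ {n} (λ i → ≡.cong g (Fin.toℕ-inject₁ i))))
            (reflexive (≡.cong g (Fin.toℕ-fromℕ n))))

  *-sub-split : ∀ u v x y z → (u * v) * (x - z) ≈ u * (v * (x - y)) + ((y - z) * u) * v
  *-sub-split u v x y z = trans (*-congˡ (sub-telescope x y z))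
    (solve 4 (λ u v x-y y-z → (u :* v) :* (x-y :+ y-z) := u :* (v :* x-y) :+ (y-z :* u) :* v)
           refl u v (x - y) (y - z))

  bilinear-sum : ∀ {r s} (α a : Vector Carrier r) (β b : Vector Carrier s) w →
                 (∑[ i < r ] (α i * a i) * ∑[ j < s ] (β j * b j)) * w
                 ≈ ∑[ i < r ] ∑[ j < s ] ((α i * β j) * ((a i * b j) * w))
  bilinear-sum {r} {s} α a β b w = begin
    (∑[ i < r ] (α i * a i) * ∑[ j < s ] (β j * b j)) * w
      ≈⟨ *-congʳ (sum-*-sum (λ i → α i * a i) (λ j → β j * b j)) ⟩
    (∑[ i < r ] ∑[ j < s ] ((α i * a i) * (β j * b j))) * w
      ≈⟨ *-distribʳ-sum w (λ i → ∑[ j < s ] ((α i * a i) * (β j * b j))) ⟩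
    ∑[ i < r ] ((∑[ j < s ] ((α i * a i) * (β j * b j))) * w)
      ≈⟨ sum-cong-≋ {r} (λ i → *-distribʳ-sum w (λ j → (α i * a i) * (β j * b j))) ⟩
    ∑[ i < r ] ∑[ j < s ] (((α i * a i) * (β j * b j)) * w)
      ≈⟨ sum-cong-≋ {r} (λ i → sum-cong-≋ {s} (λ j →
           solve 5 (λ α a β b w → ((α :* a) :* (β :* b)) :* w := (α :* β) :* ((a :* b) :* w))
                 refl (α i) (a i) (β j) (b j) w)) ⟩
    ∑[ i < r ] ∑[ j < s ] ((α i * β j) * ((a i * b j) * w))
      ∎

  private variable
    a b : Level
    A : Set a
    B : Set b

  ∑ₗ : List A → (A → Carrier) → Carrier
  ∑ₗ xs f = List.foldr _+_ 0# (List.map f xs)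

  ∑ₗ-cong : ∀ (xs : List A) {f g : A → Carrier} → (∀ x → f x ≈ g x) → ∑ₗ xs f ≈ ∑ₗ xs g
  ∑ₗ-cong []       f≈g = refl
  ∑ₗ-cong (x ∷ xs) f≈g = +-cong (f≈g x) (∑ₗ-cong xs f≈g)

  ∑ₗ-zero : ∀ (xs : List A) → ∑ₗ xs (λ _ → 0#) ≈ 0#
  ∑ₗ-zero []       = refl
  ∑ₗ-zero (x ∷ xs) = trans (+-identityˡ _) (∑ₗ-zero xs)

  ∑ₗ-distrib-+ : ∀ (xs : List A) (f g : A → Carrier) →
                 ∑ₗ xs (λ x → f x + g x) ≈ ∑ₗ xs f + ∑ₗ xs g
  ∑ₗ-distrib-+ []       f g = sym (+-identityʳ 0#)
  ∑ₗ-distrib-+ (x ∷ xs) f g = trans (+-congˡ (∑ₗ-distrib-+ xs f g))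
    (solve 4 (λ a b c d → (a :+ b) :+ (c :+ d) := (a :+ c) :+ (b :+ d)) refl _ _ _ _)

  *-distribˡ-∑ₗ : ∀ k (xs : List A) (f : A → Carrier) → k * ∑ₗ xs f ≈ ∑ₗ xs (λ x → k * f x)
  *-distribˡ-∑ₗ k []       f = zeroʳ k
  *-distribˡ-∑ₗ k (x ∷ xs) f = trans (distribˡ k _ _) (+-congˡ (*-distribˡ-∑ₗ k xs f))

  -‿distrib-∑ₗ : ∀ (xs : List A) (f : A → Carrier) → - ∑ₗ xs f ≈ ∑ₗ xs (λ x → - f x)
  -‿distrib-∑ₗ []       f = -0#≈0#
  -‿distrib-∑ₗ (x ∷ xs) f = trans (sym (⁻¹-∙-comm _ _)) (+-congˡ (-‿distrib-∑ₗ xs f))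

  ∑ₗ-filter : ∀ {p} {P : A → Set p} (P? : ∀ x → Dec (P x)) (xs : List A) (f : A → Carrier) →
              ∑ₗ (List.filter P? xs) f ≈ ∑ₗ xs (λ x → if does (P? x) then f x else 0#)
  ∑ₗ-filter P? []       f = refl
  ∑ₗ-filter P? (x ∷ xs) f with does (P? x)
  ... | true  = +-congˡ (∑ₗ-filter P? xs f)
  ... | false = trans (∑ₗ-filter P? xs f) (sym (+-identityˡ _))

  ∑ₗ-sum : ∀ (xs : List A) {n} (f : Fin n → A → Carrier) →
           ∑ₗ xs (λ x → ∑[ i < n ] f i x) ≈ ∑[ i < n ] ∑ₗ xs (f i)
  ∑ₗ-sum []       {n} f = sym (sum-zero {n} (λ _ → refl))
  ∑ₗ-sum (x ∷ xs) {n} f = trans (+-congˡ (∑ₗ-sum xs f)) (sym (∑-distrib-+ (λ i → f i x) _))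

  ∑ₗ-comm : ∀ (xs : List A) (ys : List B) (f : A → B → Carrier) →
            ∑ₗ xs (λ x → ∑ₗ ys (f x)) ≈ ∑ₗ ys (λ y → ∑ₗ xs (λ x → f x y))
  ∑ₗ-comm []       ys f = sym (∑ₗ-zero ys)
  ∑ₗ-comm (x ∷ xs) ys f = trans (+-congˡ (∑ₗ-comm xs ys f))
                               (sym (∑ₗ-distrib-+ ys (f x) _))

  ∑ₗ-map : ∀ (e : A → B) (xs : List A) (f : B → Carrier) → ∑ₗ (List.map e xs) f ≡ ∑ₗ xs (f ∘ e)
  ∑ₗ-map e xs f = ≡.cong (List.foldr _+_ 0#) (≡.sym (List.map-∘ xs))

  ∑ₗ-concatMap : ∀ (h : A → List B) (xs : List A) (f : B → Carrier) →
                 ∑ₗ (List.concatMap h xs) f ≈ ∑ₗ xs (λ x → ∑ₗ (h x) f)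
  ∑ₗ-concatMap h []       f = refl
  ∑ₗ-concatMap h (x ∷ xs) f = trans (∑ₗ-++ (h x) _ f) (+-congˡ (∑ₗ-concatMap h xs f))
    where
    ∑ₗ-++ : ∀ (ys zs : List B) (f : B → Carrier) → ∑ₗ (ys ++ zs) f ≈ ∑ₗ ys f + ∑ₗ zs f
    ∑ₗ-++ []       zs f = sym (+-identityˡ _)
    ∑ₗ-++ (y ∷ ys) zs f = trans (+-congˡ (∑ₗ-++ ys zs f)) (sym (+-assoc _ _ _))

  -- allFuns extends functions by a private operation of its own, equal to _◂_ only pointwise;
  -- hence the congruence hypotheses.
  ∑ₗ-allFuns-suc : ∀ n k (G : (Fin (suc n) → Fin k) → Carrier) → Congruent _≗_ _≈_ G →
                   ∑ₗ (allFuns (suc n) k) G ≈ ∑ₗ (allFuns n k) (λ f → ∑ₗ (List.allFin k) (λ j → G (j ◂ f)))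
  ∑ₗ-allFuns-suc n k G G-cong = trans (∑ₗ-concatMap _ (allFuns n k) G) (∑ₗ-cong (allFuns n k) λ f →
    trans (reflexive (∑ₗ-map _ (List.allFin k) G))
          (∑ₗ-cong (List.allFin k) (λ j → G-cong λ { 0F → ≡.refl ; (Fin.suc i) → ≡.refl })))

  ∑ₗ-allFuns-suc² : ∀ n k (G : (Fin (2 ℕ.+ n) → Fin k) → Carrier) → Congruent _≗_ _≈_ G →
                    ∑ₗ (allFuns (2 ℕ.+ n) k) G
                    ≈ ∑ₗ (allFuns n k) (λ f →
                        ∑ₗ (List.allFin k) (λ j′ → ∑ₗ (List.allFin k) (λ j → G (j ◂ j′ ◂ f))))
  ∑ₗ-allFuns-suc² n k G G-cong = trans (∑ₗ-allFuns-suc (suc n) k G G-cong)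
    (∑ₗ-allFuns-suc n k (λ f → ∑ₗ (List.allFin k) (λ j → G (j ◂ f)))
      (λ f≗f′ → ∑ₗ-cong (List.allFin k) (λ j → G-cong λ { 0F → ≡.refl ; (Fin.suc i) → f≗f′ i })))

  ∑ₗ-allFuns-swap01 : ∀ n k (G : (Fin (2 ℕ.+ n) → Fin k) → Carrier) → Congruent _≗_ _≈_ G →
                      ∑ₗ (allFuns (2 ℕ.+ n) k) G ≈ ∑ₗ (allFuns (2 ℕ.+ n) k) (G ∘ (_∘ swap01))
  ∑ₗ-allFuns-swap01 n k G G-cong = begin
    ∑ₗ (allFuns (2 ℕ.+ n) k) G
      ≈⟨ ∑ₗ-allFuns-suc² n k G G-cong ⟩
    ∑ₗ (allFuns n k) (λ f → ∑ₗ (List.allFin k) (λ j′ → ∑ₗ (List.allFin k) (λ j → G (j ◂ j′ ◂ f))))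
      ≈⟨ ∑ₗ-cong (allFuns n k) (λ f → trans (∑ₗ-comm (List.allFin k) (List.allFin k) _)
           (∑ₗ-cong (List.allFin k) λ u → ∑ₗ-cong (List.allFin k) λ v → G-cong (swapped u v f))) ⟩
    ∑ₗ (allFuns n k) (λ f → ∑ₗ (List.allFin k) (λ j′ → ∑ₗ (List.allFin k) (λ j → G ((j ◂ j′ ◂ f) ∘ swap01))))
      ≈⟨ ∑ₗ-allFuns-suc² n k (G ∘ (_∘ swap01)) (λ ω≗ω′ → G-cong (ω≗ω′ ∘ swap01)) ⟨
    ∑ₗ (allFuns (2 ℕ.+ n) k) (G ∘ (_∘ swap01))
      ∎
    where
    swapped : ∀ j j′ (f : Fin n → Fin k) → (j ◂ j′ ◂ f) ≗ (j′ ◂ j ◂ f) ∘ swap01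
    swapped j j′ f 0F                    = ≡.refl
    swapped j j′ f 1F                    = ≡.refl
    swapped j j′ f (Fin.suc (Fin.suc i)) = ≡.refl

module PowerSeries {c ℓ} (R : CommutativeRing c ℓ) where
  open CommutativeRing R hiding (zero)
  open import Algebra.Solver.Ring.NaturalCoefficients.Default commutativeSemiring
    using (solve; _:=_; _:+_; _:*_)
  open import Relation.Binary.Reasoning.Setoid setoid

  infix 4 _≐_
  _≐_ : (ℕ → Carrier) → (ℕ → Carrier) → Set ℓ
  S ≐ T = ∀ k → S k ≈ T k

  shift : (ℕ → Carrier) → ℕ → Carrier
  shift S zero    = 0#
  shift S (suc k) = S k

  linMul : Carrier → (ℕ → Carrier) → ℕ → Carrier
  linMul z S k = S k + z * shift S k

  -- multiplication by 1 / (1 - y t)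
  geomMul : Carrier → (ℕ → Carrier) → ℕ → Carrier
  geomMul y S zero    = S zero
  geomMul y S (suc k) = S (suc k) + y * geomMul y S k

  linMuls : List Carrier → (ℕ → Carrier) → ℕ → Carrier
  linMuls zs S = List.foldr linMul S zs

  geomMuls : List Carrier → (ℕ → Carrier) → ℕ → Carrier
  geomMuls ys S = List.foldr geomMul S ys

  shift-cong : ∀ {S T} → S ≐ T → shift S ≐ shift T
  shift-cong S≐T zero    = refl
  shift-cong S≐T (suc k) = S≐T k

  shift-linear : ∀ S T a → shift (λ k → S k + a * T k) ≐ (λ k → shift S k + a * shift T k)
  shift-linear S T a zero    = sym (trans (+-identityˡ _) (zeroʳ a))
  shift-linear S T a (suc k) = refl

  geomMul-unfold : ∀ y S → geomMul y S ≐ (λ k → S k + y * shift (geomMul y S) k)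
  geomMul-unfold y S zero    = sym (trans (+-congˡ (zeroʳ y)) (+-identityʳ _))
  geomMul-unfold y S (suc k) = refl

  geomMul-unique : ∀ y S T → T ≐ (λ k → S k + y * shift T k) → T ≐ geomMul y S
  geomMul-unique y S T T≐ zero    = trans (T≐ zero) (trans (+-congˡ (zeroʳ y)) (+-identityʳ _))
  geomMul-unique y S T T≐ (suc k) = trans (T≐ (suc k)) (+-congˡ (*-congˡ (geomMul-unique y S T T≐ k)))

  record IsShiftLinear (O : (ℕ → Carrier) → ℕ → Carrier) : Set (c ⊔ ℓ) where
    field
      cong       : ∀ {S T} → S ≐ T → O S ≐ O T
      linear     : ∀ S T a → O (λ k → S k + a * T k) ≐ (λ k → O S k + a * O T k)
      shift-comm : ∀ S → O (shift S) ≐ shift (O S)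

  linMul-isShiftLinear : ∀ z → IsShiftLinear (linMul z)
  linMul-isShiftLinear z = record
    { cong       = λ S≐T k → +-cong (S≐T k) (*-congˡ (shift-cong S≐T k))
    ; linear     = linear
    ; shift-comm = shift-comm
    }
    where
    linear : ∀ S T a → linMul z (λ k → S k + a * T k) ≐ (λ k → linMul z S k + a * linMul z T k)
    linear S T a k = trans (+-congˡ (*-congˡ (shift-linear S T a k)))
      (solve 6 (λ s t s′ t′ a z → (s :+ a :* t) :+ z :* (s′ :+ a :* t′)
                                  := (s :+ z :* s′) :+ a :* (t :+ z :* t′))
             refl (S k) (T k) (shift S k) (shift T k) a z)
    shift-comm : ∀ S → linMul z (shift S) ≐ shift (linMul z S)
    shift-comm S zero    = trans (+-identityˡ _) (zeroʳ z)
    shift-comm S (suc k) = refl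

  geomMul-isShiftLinear : ∀ y → IsShiftLinear (geomMul y)
  geomMul-isShiftLinear y = record { cong = cong ; linear = linear ; shift-comm = shift-comm }
    where
    cong : ∀ {S T} → S ≐ T → geomMul y S ≐ geomMul y T
    cong S≐T zero    = S≐T zero
    cong S≐T (suc k) = +-cong (S≐T (suc k)) (*-congˡ (cong S≐T k))
    linear : ∀ S T a → geomMul y (λ k → S k + a * T k) ≐ (λ k → geomMul y S k + a * geomMul y T k)
    linear S T a zero    = refl
    linear S T a (suc k) = trans (+-congˡ (*-congˡ (linear S T a k)))
      (solve 6 (λ s t s′ t′ a y → (s :+ a :* t) :+ y :* (s′ :+ a :* t′)
                                  := (s :+ y :* s′) :+ a :* (t :+ y :* t′))
             refl (S (suc k)) (T (suc k)) (geomMul y S k) (geomMul y T k) a y)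
    shift-comm : ∀ S → geomMul y (shift S) ≐ shift (geomMul y S)
    shift-comm S zero          = refl
    shift-comm S (suc zero)    = trans (+-congˡ (zeroʳ y)) (+-identityʳ _)
    shift-comm S (suc (suc k)) = +-congˡ (*-congˡ (shift-comm S (suc k)))

  module _ {O : (ℕ → Carrier) → ℕ → Carrier} (O-lin : IsShiftLinear O) where
    open IsShiftLinear O-lin

    linMul-comm : ∀ z S → O (linMul z S) ≐ linMul z (O S)
    linMul-comm z S k = trans (linear S (shift S) z k) (+-congˡ (*-congˡ (shift-comm S k)))

    geomMul-comm : ∀ y S → O (geomMul y S) ≐ geomMul y (O S)
    geomMul-comm y S = geomMul-unique y (O S) (O (geomMul y S)) λ k → begin
      O (geomMul y S) k                                ≈⟨ cong (geomMul-unfold y S) k ⟩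
      O (λ j → S j + y * shift (geomMul y S) j) k      ≈⟨ linear S (shift (geomMul y S)) y k ⟩
      O S k + y * O (shift (geomMul y S)) k            ≈⟨ +-congˡ (*-congˡ (shift-comm (geomMul y S) k)) ⟩
      O S k + y * shift (O (geomMul y S)) k            ∎

    linMuls-comm : ∀ zs S → O (linMuls zs S) ≐ linMuls zs (O S)
    linMuls-comm []       S = λ _ → refl
    linMuls-comm (z ∷ zs) S k = trans (linMul-comm z (linMuls zs S) k)
      (IsShiftLinear.cong (linMul-isShiftLinear z) (linMuls-comm zs S) k)

    geomMuls-comm : ∀ ys S → O (geomMuls ys S) ≐ geomMuls ys (O S)
    geomMuls-comm []       S = λ _ → refl
    geomMuls-comm (y ∷ ys) S k = trans (geomMul-comm y (geomMuls ys S) k)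
      (IsShiftLinear.cong (geomMul-isShiftLinear y) (geomMuls-comm ys S) k)

  linMuls-cong : ∀ zs {S T} → S ≐ T → linMuls zs S ≐ linMuls zs T
  linMuls-cong []       S≐T = S≐T
  linMuls-cong (z ∷ zs) S≐T = IsShiftLinear.cong (linMul-isShiftLinear z) (linMuls-cong zs S≐T)

  linMuls-snoc : ∀ zs z S → linMuls (zs ∷ʳ z) S ≐ linMul z (linMuls zs S)
  linMuls-snoc zs z S k = begin
    linMuls (zs ∷ʳ z) S k        ≡⟨ ≡.cong (λ T → T k) (List.foldr-++ linMul S zs (z ∷ [])) ⟩
    linMuls zs (linMul z S) k    ≈⟨ linMuls-comm (linMul-isShiftLinear z) zs S k ⟨
    linMul z (linMuls zs S) k    ∎

  geomMuls-snoc : ∀ ys y S → geomMuls (ys ∷ʳ y) S ≐ geomMul y (geomMuls ys S)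
  geomMuls-snoc ys y S k = begin
    geomMuls (ys ∷ʳ y) S k       ≡⟨ ≡.cong (λ T → T k) (List.foldr-++ geomMul S ys (y ∷ [])) ⟩
    geomMuls ys (geomMul y S) k  ≈⟨ geomMuls-comm (geomMul-isShiftLinear y) ys S k ⟨
    geomMul y (geomMuls ys S) k  ∎

  linMul-geomMul-suc : ∀ z y S n → linMul z (geomMul y S) (suc n) ≈ S (suc n) + (y + z) * geomMul y S n
  linMul-geomMul-suc z y S n =
    solve 4 (λ s y z g → (s :+ y :* g) :+ z :* g := s :+ (y :+ z) :* g) refl (S (suc n)) y z (geomMul y S n)

  linMuls-at0 : ∀ zs S → linMuls zs S 0 ≈ S 0
  linMuls-at0 []       S = refl
  linMuls-at0 (z ∷ zs) S = trans (trans (+-congˡ (zeroʳ z)) (+-identityʳ _)) (linMuls-at0 zs S)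

  geomMuls-at0 : ∀ ys S → geomMuls ys S 0 ≈ S 0
  geomMuls-at0 []       S = refl
  geomMuls-at0 (y ∷ ys) S = geomMuls-at0 ys S

  linMuls-vanish : ∀ {p S} → (∀ k → p < k → S k ≈ 0#) →
                   ∀ zs k → List.length zs ℕ.+ p < k → linMuls zs S k ≈ 0#
  linMuls-vanish S≈0 []       k p<k = S≈0 k p<k
  linMuls-vanish {S = S} S≈0 (z ∷ zs) (suc k) (s≤s lt) = begin
    T (suc k) + z * T k   ≈⟨ +-cong (linMuls-vanish S≈0 zs (suc k) (ℕ.m<n⇒m<1+n lt))
                                    (*-congˡ (linMuls-vanish S≈0 zs k lt)) ⟩
    0# + z * 0#           ≈⟨ trans (+-identityˡ _) (zeroʳ z) ⟩
    0#                    ∎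
    where
    T : ℕ → Carrier
    T = linMuls zs S

module SuperComplete {c ℓ} (F : CharZeroField c ℓ) where
  open CharZeroField F hiding (zero)
  open RingLemmas commRing
  open PowerSeries commRing
  open import Algebra.Solver.Ring.NaturalCoefficients.Default commutativeSemiring
    using (solve; _:=_; _:+_; _:*_)
  open import Relation.Binary.Reasoning.Setoid setoid

  sumFin≡sum : ∀ n (f : Fin n → Carrier) → sumFin F n f ≡ sum f
  sumFin≡sum zero    f = ≡.refl
  sumFin≡sum (suc n) f = ≡.cong (f 0F +_) (sumFin≡sum n (f ∘ Fin.suc))

  sum1-sum1≈∑∑ : ∀ r s (h : ℕ → ℕ → Carrier) →
                 sum1 F r (λ r′ → sum1 F s (h r′)) ≈ ∑[ i < r ] ∑[ j < s ] h (suc (toℕ i)) (suc (toℕ j))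
  sum1-sum1≈∑∑ r s h = trans (reflexive (sumFin≡sum r _))
    (sum-cong-≋ {r} λ i → reflexive (sumFin≡sum s (λ j → h (suc (toℕ i)) (suc (toℕ j)))))

  prodFin-snoc : ∀ n (g : ℕ → Carrier) → prodFin F (suc n) (g ∘ toℕ) ≈ prodFin F n (g ∘ toℕ) * g n
  prodFin-snoc zero    g = trans (*-identityʳ _) (sym (*-identityˡ _))
  prodFin-snoc (suc n) g = trans (*-congˡ (prodFin-snoc n (g ∘ suc))) (sym (*-assoc _ _ _))

  fpow-suc : ∀ t (c : ℕ → Carrier) n → fpow F t c (suc n) ≈ fpow F t c n * (t - c (suc n))
  fpow-suc t c n = prodFin-snoc n (λ k → t - c (suc k))

  mulS-sum : ∀ S T k → mulS F S T k ≈ sumBelow (suc k) (λ i → S i * T (k ∸ i))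
  mulS-sum S T k = reflexive (sumFin≡sum (suc k) (λ i → S (toℕ i) * T (k ∸ toℕ i)))

  mulS-cong : ∀ {S S′ T T′} → S ≐ S′ → T ≐ T′ → mulS F S T ≐ mulS F S′ T′
  mulS-cong {S} {S′} {T} {T′} S≐S′ T≐T′ k = begin
    mulS F S T k
      ≈⟨ mulS-sum S T k ⟩
    sumBelow (suc k) (λ i → S i * T (k ∸ i))
      ≈⟨ sumBelow-cong (suc k) (λ i _ → *-cong (S≐S′ i) (T≐T′ (k ∸ i))) ⟩
    sumBelow (suc k) (λ i → S′ i * T′ (k ∸ i))
      ≈⟨ mulS-sum S′ T′ k ⟨
    mulS F S′ T′ k
      ∎

  mulS-isShiftLinearˡ : ∀ T → IsShiftLinear (λ S → mulS F S T)
  mulS-isShiftLinearˡ T = record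
    { cong       = λ S≐S′ → mulS-cong S≐S′ (λ _ → refl)
    ; linear     = linear
    ; shift-comm = shift-comm
    }
    where
    linear : ∀ S S′ a → mulS F (λ j → S j + a * S′ j) T ≐ (λ k → mulS F S T k + a * mulS F S′ T k)
    linear S S′ a k = begin
      mulS F (λ j → S j + a * S′ j) T k
        ≈⟨ mulS-sum (λ j → S j + a * S′ j) T k ⟩
      sumBelow (suc k) (λ i → (S i + a * S′ i) * T (k ∸ i))
        ≈⟨ sumBelow-cong (suc k) (λ i _ → solve 4 (λ s a s′ t → (s :+ a :* s′) :* t := s :* t :+ a :* (s′ :* t))
                                                  refl (S i) a (S′ i) (T (k ∸ i))) ⟩
      sumBelow (suc k) (λ i → S i * T (k ∸ i) + a * (S′ i * T (k ∸ i)))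
        ≈⟨ sumBelow-distrib-+ (suc k) (λ i → S i * T (k ∸ i)) (λ i → a * (S′ i * T (k ∸ i))) ⟩
      sumBelow (suc k) (λ i → S i * T (k ∸ i)) + sumBelow (suc k) (λ i → a * (S′ i * T (k ∸ i)))
        ≈⟨ +-cong (mulS-sum S T k)
                  (trans (*-congˡ (mulS-sum S′ T k)) (*-distribˡ-sumBelow (suc k) a (λ i → S′ i * T (k ∸ i)))) ⟨
      mulS F S T k + a * mulS F S′ T k
        ∎
    shift-comm : ∀ S → mulS F (shift S) T ≐ shift (mulS F S T)
    shift-comm S zero    = trans (+-identityʳ _) (zeroˡ _)
    shift-comm S (suc k) = trans (+-congʳ (zeroˡ _)) (+-identityˡ _)

  mulS-identityˡ : ∀ T → mulS F (oneS F) T ≐ T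
  mulS-identityˡ T k = begin
    mulS F (oneS F) T k
      ≡⟨⟩
    1# * T k + sumFin F k (λ i → 0# * T (k ∸ suc (toℕ i)))
      ≈⟨ +-cong (*-identityˡ _) (trans (reflexive (sumFin≡sum k _)) (sum-zero {k} (λ _ → zeroˡ _))) ⟩
    T k + 0#
      ≈⟨ +-identityʳ _ ⟩
    T k
      ∎

  linS≐linMul : ∀ z → linS F z ≐ linMul z (oneS F)
  linS≐linMul z zero          = sym (trans (+-congˡ (zeroʳ z)) (+-identityʳ _))
  linS≐linMul z (suc zero)    = sym (trans (+-identityˡ _) (*-identityʳ z))
  linS≐linMul z (suc (suc k)) = sym (trans (+-identityˡ _) (zeroʳ z))

  geomS≐geomMul : ∀ y → geomS F y ≐ geomMul y (oneS F)
  geomS≐geomMul y zero    = refl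
  geomS≐geomMul y (suc k) = sym (trans (+-identityˡ _) (*-congˡ (sym (geomS≐geomMul y k))))

  mulS-linS : ∀ z T → mulS F (linS F z) T ≐ linMul z T
  mulS-linS z T k = begin
    mulS F (linS F z) T k             ≈⟨ mulS-cong {T = T} (linS≐linMul z) (λ _ → refl) k ⟩
    mulS F (linMul z (oneS F)) T k    ≈⟨ linMul-comm (mulS-isShiftLinearˡ T) z (oneS F) k ⟩
    linMul z (mulS F (oneS F) T) k    ≈⟨ IsShiftLinear.cong (linMul-isShiftLinear z) (mulS-identityˡ T) k ⟩
    linMul z T k                      ∎

  mulS-geomS : ∀ y T → mulS F (geomS F y) T ≐ geomMul y T
  mulS-geomS y T k = begin
    mulS F (geomS F y) T k            ≈⟨ mulS-cong {T = T} (geomS≐geomMul y) (λ _ → refl) k ⟩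
    mulS F (geomMul y (oneS F)) T k   ≈⟨ geomMul-comm (mulS-isShiftLinearˡ T) y (oneS F) k ⟩
    geomMul y (mulS F (oneS F) T) k   ≈⟨ IsShiftLinear.cong (geomMul-isShiftLinear y) (mulS-identityˡ T) k ⟩
    geomMul y T k                     ∎

  hSeries : List Carrier → List Carrier → ℕ → Carrier
  hSeries ys zs = linMuls zs (geomMuls ys (oneS F))

  hSuper≐hSeries : ∀ ys zs → hSuper F ys zs ≐ hSeries ys zs
  hSuper≐hSeries ys zs k = begin
    hSuper F ys zs k                                          ≈⟨ mulS-cong (linFactors zs) (geomFactors ys) k ⟩
    mulS F (linMuls zs (oneS F)) (geomMuls ys (oneS F)) k     ≈⟨ linMuls-comm (mulS-isShiftLinearˡ _) zs _ k ⟩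
    linMuls zs (mulS F (oneS F) (geomMuls ys (oneS F))) k     ≈⟨ linMuls-cong zs (mulS-identityˡ _) k ⟩
    hSeries ys zs k                                           ∎
    where
    linFactors : ∀ zs → List.foldr (λ z S → mulS F (linS F z) S) (oneS F) zs ≐ linMuls zs (oneS F)
    linFactors []       = λ _ → refl
    linFactors (z ∷ zs) k =
      trans (mulS-cong {S = linS F z} (λ _ → refl) (linFactors zs) k) (mulS-linS z _ k)
    geomFactors : ∀ ys → List.foldr (λ y S → mulS F (geomS F y) S) (oneS F) ys ≐ geomMuls ys (oneS F)
    geomFactors []       = λ _ → refl
    geomFactors (y ∷ ys) k =
      trans (mulS-cong {S = geomS F y} (λ _ → refl) (geomFactors ys) k) (mulS-geomS y _ k)

  hSeries-snocʸ : ∀ ys y zs → hSeries (ys ∷ʳ y) zs ≐ geomMul y (hSeries ys zs)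
  hSeries-snocʸ ys y zs k = begin
    linMuls zs (geomMuls (ys ∷ʳ y) (oneS F)) k      ≈⟨ linMuls-cong zs (geomMuls-snoc ys y (oneS F)) k ⟩
    linMuls zs (geomMul y (geomMuls ys (oneS F))) k ≈⟨ linMuls-comm (geomMul-isShiftLinear y) zs _ k ⟨
    geomMul y (hSeries ys zs) k                     ∎

  hSuper-snoc : ∀ ys y zs z n →
    hSuper F (ys ∷ʳ y) (zs ∷ʳ z) (suc n) ≈ hSuper F ys zs (suc n) + (y + z) * hSuper F (ys ∷ʳ y) zs n
  hSuper-snoc ys y zs z n = begin
    hSuper F (ys ∷ʳ y) (zs ∷ʳ z) (suc n)
      ≈⟨ hSuper≐hSeries (ys ∷ʳ y) (zs ∷ʳ z) (suc n) ⟩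
    linMuls (zs ∷ʳ z) (geomMuls (ys ∷ʳ y) (oneS F)) (suc n)
      ≈⟨ linMuls-snoc zs z _ (suc n) ⟩
    linMul z (hSeries (ys ∷ʳ y) zs) (suc n)
      ≈⟨ IsShiftLinear.cong (linMul-isShiftLinear z) (hSeries-snocʸ ys y zs) (suc n) ⟩
    linMul z (geomMul y (hSeries ys zs)) (suc n)
      ≈⟨ linMul-geomMul-suc z y (hSeries ys zs) n ⟩
    hSeries ys zs (suc n) + (y + z) * geomMul y (hSeries ys zs) n
      ≈⟨ +-cong (hSuper≐hSeries ys zs (suc n))
                (*-congˡ (trans (hSuper≐hSeries (ys ∷ʳ y) zs n) (hSeries-snocʸ ys y zs n))) ⟨
    hSuper F ys zs (suc n) + (y + z) * hSuper F (ys ∷ʳ y) zs n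
      ∎

  hSuper-at0 : ∀ ys zs → hSuper F ys zs 0 ≈ 1#
  hSuper-at0 ys zs = trans (hSuper≐hSeries ys zs 0)
                           (trans (linMuls-at0 zs _) (geomMuls-at0 ys (oneS F)))

  hSuper-vanish : ∀ zs k → List.length zs < k → hSuper F [] zs k ≈ 0#
  hSuper-vanish zs k len<k = trans (hSuper≐hSeries [] zs k)
    (linMuls-vanish oneS≈0 zs k (≡.subst (_< k) (≡.sym (ℕ.+-identityʳ _)) len<k))
    where
    oneS≈0 : ∀ k → 0 < k → oneS F k ≈ 0#
    oneS≈0 (suc k) _ = refl

  module Coefficients (a b : ℕ → Carrier) where

    bs : ℕ → List Carrier
    bs r′ = List.map (λ i → b (2 ℕ.+ i)) (List.upTo r′)

    as : ℕ → List Carrier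
    as r = List.map (λ i → - a (2 ℕ.+ i)) (List.upTo (r ∸ 1))

    D : ℕ → ℕ → Carrier
    D r r′ = d F r r′ a b

    D-unfold : ∀ r r′ → r′ ≤ r → D r r′ ≡ hSuper F (bs r′) (as r) (r ∸ r′)
    D-unfold r r′ r′≤r with r <? r′
    ... | yes r<r′ = contradiction r′≤r (ℕ.<⇒≱ r<r′)
    ... | no  _    = ≡.refl

    D-above : ∀ r r′ → r < r′ → D r r′ ≡ 0#
    D-above r r′ r<r′ with r <? r′
    ... | yes _    = ≡.refl
    ... | no  r≮r′ = contradiction r<r′ r≮r′

    D-diag : ∀ r → D r r ≈ 1#
    D-diag r = trans (reflexive (D-unfold r r ℕ.≤-refl))
      (≡.subst (λ k → hSuper F (bs r) (as r) k ≈ 1#) (≡.sym (ℕ.n∸n≡0 r)) (hSuper-at0 (bs r) (as r)))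

    D-col0 : ∀ q → D (suc q) 0 ≈ 0#
    D-col0 q = trans (reflexive (D-unfold (suc q) 0 z≤n)) (hSuper-vanish (as (suc q)) (suc q) len<)
      where
      len< : List.length (as (suc q)) < suc q
      len< = ≡.subst (_< suc q) (≡.sym (≡.trans (List.length-map _ (List.upTo q)) (List.length-upTo q)))
                     ℕ.≤-refl

    D-rec : ∀ q j → j ≤ suc q →
            D (2 ℕ.+ q) (suc j) ≈ D (suc q) j + (b (2 ℕ.+ j) - a (2 ℕ.+ q)) * D (suc q) (suc j)
    D-rec q j j≤1+q with ℕ.m≤n⇒m<n∨m≡n j≤1+q
    ... | inj₂ ≡.refl = begin
      D (2 ℕ.+ q) (2 ℕ.+ q)                        ≈⟨ trans (D-diag (2 ℕ.+ q)) (sym (D-diag (suc q))) ⟩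
      D (suc q) (suc q)                            ≈⟨ trans (+-congˡ (zeroʳ γ)) (+-identityʳ _) ⟨
      D (suc q) (suc q) + γ * 0#                   ≡⟨ ≡.cong (λ t → D (suc q) (suc q) + γ * t)
                                                             (D-above (suc q) (2 ℕ.+ q) ℕ.≤-refl) ⟨
      D (suc q) (suc q) + γ * D (suc q) (2 ℕ.+ q)  ∎
      where
      γ : Carrier
      γ = b (3 ℕ.+ q) - a (2 ℕ.+ q)
    ... | inj₁ (s≤s j≤q) = begin
      D (2 ℕ.+ q) (suc j)
        ≡⟨ D-unfold (2 ℕ.+ q) (suc j) (s≤s j≤1+q) ⟩
      hSuper F (bs (suc j)) (as (2 ℕ.+ q)) (suc q ∸ j)
        ≡⟨ ≡.cong₂ (λ ys n → hSuper F ys (as (2 ℕ.+ q)) n) (map-upTo-suc _ j) (ℕ.+-∸-assoc 1 j≤q) ⟩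
      hSuper F (bs j ∷ʳ y) (as (2 ℕ.+ q)) (suc (q ∸ j))
        ≡⟨ ≡.cong (λ zs → hSuper F (bs j ∷ʳ y) zs (suc (q ∸ j))) (map-upTo-suc _ q) ⟩
      hSuper F (bs j ∷ʳ y) (as (suc q) ∷ʳ z) (suc (q ∸ j))
        ≈⟨ hSuper-snoc (bs j) y (as (suc q)) z (q ∸ j) ⟩
      hSuper F (bs j) (as (suc q)) (suc (q ∸ j)) + (y + z) * hSuper F (bs j ∷ʳ y) (as (suc q)) (q ∸ j)
        ≡⟨ ≡.cong₂ (λ n ys → hSuper F (bs j) (as (suc q)) n + (y + z) * hSuper F ys (as (suc q)) (q ∸ j))
                   (ℕ.+-∸-assoc 1 j≤q) (map-upTo-suc _ j) ⟨
      hSuper F (bs j) (as (suc q)) (suc q ∸ j) + (y + z) * hSuper F (bs (suc j)) (as (suc q)) (q ∸ j)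
        ≡⟨ ≡.cong₂ (λ u v → u + (y + z) * v) (D-unfold (suc q) j j≤1+q) (D-unfold (suc q) (suc j) (s≤s j≤q)) ⟨
      D (suc q) j + (y + z) * D (suc q) (suc j)
        ∎
      where
      y z : Carrier
      y = b (2 ℕ.+ j)
      z = - a (2 ℕ.+ q)

    expansion : a 1 ≈ b 1 → ∀ {r} → 1 ≤ r → ∀ t →
                fpow F t a r ≈ sumBelow r (λ j → D r (suc j) * fpow F t b (suc j))
    expansion a₁≈b₁ {1} _ t = begin
      (t - a 1) * 1#                   ≈⟨ *-congʳ (+-congˡ (-‿cong a₁≈b₁)) ⟩
      (t - b 1) * 1#                   ≈⟨ *-identityˡ _ ⟨
      1# * ((t - b 1) * 1#)            ≈⟨ *-congʳ (D-diag 1) ⟨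
      D 1 1 * ((t - b 1) * 1#)         ≈⟨ +-identityʳ _ ⟨
      D 1 1 * ((t - b 1) * 1#) + 0#    ∎
    expansion a₁≈b₁ {suc (suc q)} _ t = begin
      fpow F t a (2 ℕ.+ q)
        ≈⟨ fpow-suc t a (suc q) ⟩
      fpow F t a (suc q) * A
        ≈⟨ *-congʳ (expansion a₁≈b₁ {suc q} (s≤s z≤n) t) ⟩
      sumBelow (suc q) (λ j → E (suc j) * G j) * A
        ≈⟨ *-distribʳ-sumBelow (suc q) A (λ j → E (suc j) * G j) ⟩
      sumBelow (suc q) (λ j → (E (suc j) * G j) * A)
        ≈⟨ sumBelow-cong (suc q) (λ j _ → step j) ⟩
      sumBelow (suc q) (λ j → lower (suc j) + upper j)
        ≈⟨ sumBelow-distrib-+ (suc q) (lower ∘ suc) upper ⟩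
      sumBelow (suc q) (lower ∘ suc) + sumBelow (suc q) upper
        ≈⟨ +-cong lower-head upper-last ⟨
      sumBelow (2 ℕ.+ q) lower + sumBelow (2 ℕ.+ q) upper
        ≈⟨ sumBelow-distrib-+ (2 ℕ.+ q) lower upper ⟨
      sumBelow (2 ℕ.+ q) (λ j → lower j + upper j)
        ≈⟨ sumBelow-cong (2 ℕ.+ q) (λ j j<2+q → trans (sym (distribʳ (G j) (E j) (γ j * E (suc j))))
                                                     (*-congʳ (sym (D-rec q j (ℕ.≤-pred j<2+q))))) ⟩
      sumBelow (2 ℕ.+ q) (λ j → D (2 ℕ.+ q) (suc j) * G j)
        ∎
      where
      A : Carrier
      A = t - a (2 ℕ.+ q)
      E G γ lower upper : ℕ → Carrier
      E = D (suc q)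
      G j = fpow F t b (suc j)
      γ j = b (2 ℕ.+ j) - a (2 ℕ.+ q)
      lower j = E j * G j
      upper j = (γ j * E (suc j)) * G j
      step : ∀ j → (E (suc j) * G j) * A ≈ lower (suc j) + upper j
      step j = trans (*-sub-split (E (suc j)) (G j) t (b (2 ℕ.+ j)) (a (2 ℕ.+ q)))
                     (+-congʳ (*-congˡ (sym (fpow-suc t b (suc j)))))
      lower-head : sumBelow (2 ℕ.+ q) lower ≈ sumBelow (suc q) (lower ∘ suc)
      lower-head = trans (+-congʳ (trans (*-congʳ (D-col0 q)) (zeroˡ _))) (+-identityˡ _)
      upper-last : sumBelow (2 ℕ.+ q) upper ≈ sumBelow (suc q) upper
      upper-last = trans (sumBelow-last (suc q) upper) (trans (+-congˡ upper≈0) (+-identityʳ _))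
        where
        upper≈0 : upper (suc q) ≈ 0#
        upper≈0 = trans (*-congʳ (trans (*-congˡ (reflexive (D-above (suc q) (2 ℕ.+ q) ℕ.≤-refl))) (zeroʳ _)))
                        (zeroˡ _)

module PairSymmetrisation {c ℓ} (F : CharZeroField c ℓ) where
  open CharZeroField F hiding (zero)
  open RingLemmas commRing
  open import Algebra.Properties.Ring ring using (-‿distribˡ-*; -‿distribʳ-*; -‿involutive; -0#≈0#)
  open import Algebra.Properties.Group +-group using (x∙y⁻¹≈ε⇒x≈y)
  open import Algebra.Properties.AbelianGroup +-abelianGroup using (⁻¹-anti-homo‿-)
  open import Algebra.Solver.Ring.NaturalCoefficients.Default commutativeSemiring
    using (solve; _:=_; _:+_; _:*_; con)
  open import Relation.Binary.Reasoning.Setoid setoid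

  ⁻¹-unique : ∀ u v → ¬ u ≈ 0# → u * v ≈ 1# → v ≈ u ⁻¹
  ⁻¹-unique u v u≉0 uv≈1 = begin
    v                ≈⟨ *-identityʳ v ⟨
    v * 1#           ≈⟨ *-congˡ (inverse u u≉0) ⟨
    v * (u * u ⁻¹)   ≈⟨ solve 3 (λ v u u⁻¹ → v :* (u :* u⁻¹) := (u :* v) :* u⁻¹) refl v u (u ⁻¹) ⟩
    (u * v) * u ⁻¹   ≈⟨ *-congʳ uv≈1 ⟩
    1# * u ⁻¹        ≈⟨ *-identityˡ _ ⟩
    u ⁻¹             ∎

  ⁻¹-of-neg : ∀ u v → ¬ v ≈ 0# → u ≈ - v → - (v ⁻¹) ≈ u ⁻¹
  ⁻¹-of-neg u v v≉0 u≈-v = ⁻¹-unique u (- (v ⁻¹)) u≉0 (begin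
    u * - (v ⁻¹)     ≈⟨ -‿distribʳ-* u (v ⁻¹) ⟨
    - (u * v ⁻¹)     ≈⟨ -‿distribˡ-* u (v ⁻¹) ⟩
    - u * v ⁻¹       ≈⟨ *-congʳ (trans (-‿cong u≈-v) (-‿involutive v)) ⟩
    v * v ⁻¹         ≈⟨ inverse v v≉0 ⟩
    1#               ∎)
    where
    u≉0 : ¬ u ≈ 0#
    u≉0 u≈0 = v≉0 (trans (sym (-‿involutive v)) (trans (-‿cong (trans (sym u≈-v) u≈0)) -0#≈0#))

  -- the only place where the characteristic matters: 2 is invertible
  x≈-x⇒x≈0 : ∀ x → x ≈ - x → x ≈ 0#
  x≈-x⇒x≈0 x x≈-x = begin
    x                      ≈⟨ *-identityˡ x ⟨
    1# * x                 ≈⟨ *-congʳ (trans (*-comm _ _) (inverse two two≉0)) ⟨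
    (two ⁻¹ * two) * x     ≈⟨ *-assoc _ _ _ ⟩
    two ⁻¹ * (two * x)     ≈⟨ *-congˡ twox≈0 ⟩
    two ⁻¹ * 0#            ≈⟨ zeroʳ _ ⟩
    0#                     ∎
    where
    two : Carrier
    two = natCast commRing 2
    two≉0 : ¬ two ≈ 0#
    two≉0 two≈0 with char0 2 two≈0
    ... | ()
    twox≈0 : two * x ≈ 0#
    twox≈0 = begin
      two * x    ≈⟨ solve 1 (λ x → (con 1 :+ (con 1 :+ con 0)) :* x := x :+ x) refl x ⟩
      x + x      ≈⟨ +-congˡ x≈-x ⟩
      x - x      ≈⟨ -‿inverseʳ x ⟩
      0#         ∎

  prodFin-cong : ∀ n {f g : Fin n → Carrier} → (∀ i → f i ≈ g i) → prodFin F n f ≈ prodFin F n g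
  prodFin-cong zero    f≈g = refl
  prodFin-cong (suc n) f≈g = *-cong (f≈g 0F) (prodFin-cong n (f≈g ∘ Fin.suc))

  prodFin-ones : ∀ n {f : Fin n → Carrier} → (∀ i → f i ≈ 1#) → prodFin F n f ≈ 1#
  prodFin-ones zero    f≈1 = refl
  prodFin-ones (suc n) f≈1 = trans (*-cong (f≈1 0F) (prodFin-ones n (f≈1 ∘ Fin.suc))) (*-identityˡ 1#)

  frac : ∀ {m} → (Fin m → Carrier) → Fin m → Fin m → Carrier
  frac x p q = (x p + x q) * (x p - x q) ⁻¹

  Distinct : ∀ {m} → (Fin m → Carrier) → Set ℓ
  Distinct x = ∀ i j → x i ≈ x j → i ≡ j

  frac-antisym : ∀ {m} {x : Fin m → Carrier} → Distinct x → ∀ {p q} → ¬ p ≡ q → frac x q p ≈ - frac x p q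
  frac-antisym {x = x} x-distinct {p} {q} p≢q = begin
    (x q + x p) * (x q - x p) ⁻¹       ≈⟨ *-cong (+-comm (x p) (x q))
                                                 (⁻¹-of-neg _ _ xp-xq≉0 (sym (⁻¹-anti-homo‿- (x p) (x q)))) ⟨
    (x p + x q) * - ((x p - x q) ⁻¹)   ≈⟨ -‿distribʳ-* _ _ ⟨
    - frac x p q                       ∎
    where
    xp-xq≉0 : ¬ x p - x q ≈ 0#
    xp-xq≉0 = p≢q ∘ x-distinct p q ∘ x∙y⁻¹≈ε⇒x≈y (x p) (x q)

  cross : ∀ {m} → (Fin m → Carrier) → (Fin m → Fin m) → Carrier
  cross {m} x ω = prodFin F m (λ i → prodFin F m (λ j →
    if does (toℕ i <? 2) ∧ does (toℕ i <? toℕ j) then frac x (ω i) (ω j) else 1#))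

  crossRow : ∀ {n} → (Fin (2 ℕ.+ n) → Carrier) → (Fin (2 ℕ.+ n) → Fin (2 ℕ.+ n)) → Fin (2 ℕ.+ n) → Carrier
  crossRow {n} x ω p = prodFin F n (λ j → frac x p (ω (Fin.suc (Fin.suc j))))

  cross-factor : ∀ {n} x (ω : Fin (2 ℕ.+ n) → Fin (2 ℕ.+ n)) →
    cross x ω ≈ frac x (ω 0F) (ω 1F) * (crossRow x ω (ω 0F) * crossRow x ω (ω 1F))
  cross-factor {n} x ω =
    trans (*-congˡ (*-congˡ (prodFin-ones n (λ _ → prodFin-ones (2 ℕ.+ n) (λ _ → refl)))))
    (solve 3 (λ f r₀ r₁ → (con 1 :* (f :* r₀)) :* ((con 1 :* (con 1 :* r₁)) :* con 1) := f :* (r₀ :* r₁))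
           refl _ _ _)

  pairTerm : (f g : Carrier → Carrier) → ∀ {n} →
             (Fin (2 ℕ.+ n) → Carrier) → (Fin (2 ℕ.+ n) → Fin (2 ℕ.+ n)) → Carrier
  pairTerm f g x ω = (f (x (ω 0F)) * g (x (ω 1F))) * cross x ω

  -- P_{(k,l);c} with (x | c)^k and (x | c)^l replaced by arbitrary functions f and g
  symPair : (f g : Carrier → Carrier) (m : ℕ) → (Fin m → Carrier) → Carrier
  symPair f g zero          x = 0#
  symPair f g (suc zero)    x = 0#
  symPair f g (suc (suc n)) x = natCast commRing (n !) ⁻¹ * ∑ₗ (Sym (2 ℕ.+ n)) (pairTerm f g x)

  _^↓_ : (ℕ → Carrier) → ℕ → Carrier → Carrier
  (c ^↓ k) t = fpow F t c k

  P≈symPair : ∀ c k l m x → P F c (k ∷ l ∷ []) m x ≈ symPair (c ^↓ k) (c ^↓ l) m x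
  P≈symPair c k l zero          x = refl
  P≈symPair c k l (suc zero)    x = refl
  P≈symPair c k l (suc (suc n)) x = *-congˡ (∑ₗ-cong (Sym (2 ℕ.+ n)) λ ω →
    *-congʳ (*-congˡ (trans (*-congˡ (prodFin-ones n (λ _ → refl))) (*-identityʳ _))))

  pairTerm-cong : ∀ f g {n} (x : Fin (2 ℕ.+ n) → Carrier) → Congruent _≗_ _≈_ (pairTerm f g x)
  pairTerm-cong f g {n} x ω≗ω′ = *-cong
    (reflexive (≡.cong₂ (λ p q → f (x p) * g (x q)) (ω≗ω′ 0F) (ω≗ω′ 1F)))
    (prodFin-cong (2 ℕ.+ n) λ i → prodFin-cong (2 ℕ.+ n) λ j → reflexive
      (≡.cong₂ (λ p q → if does (toℕ i <? 2) ∧ does (toℕ i <? toℕ j) then frac x p q else 1#)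
               (ω≗ω′ i) (ω≗ω′ j)))

  pairTerm-swap01 : ∀ f g {n} {x : Fin (2 ℕ.+ n) → Carrier} → Distinct x →
                    ∀ {ω} → IsInjective ω → pairTerm f g x (ω ∘ swap01) ≈ - pairTerm g f x ω
  pairTerm-swap01 f g {x = x} x-distinct {ω} ω-inj = begin
    (A * B) * cross x (ω ∘ swap01)
      ≈⟨ *-congˡ (cross-factor x (ω ∘ swap01)) ⟩
    (A * B) * (frac x ω₁ ω₀ * (R₁ * R₀))
      ≈⟨ *-congˡ (*-congʳ (frac-antisym x-distinct ω₀≢ω₁)) ⟩
    (A * B) * (- frac x ω₀ ω₁ * (R₁ * R₀))
      ≈⟨ trans (-‿distribʳ-* _ _) (*-congˡ (-‿distribˡ-* _ _)) ⟨
    - ((A * B) * (frac x ω₀ ω₁ * (R₁ * R₀)))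
      ≈⟨ -‿cong (solve 5 (λ A B F R₀ R₁ → (A :* B) :* (F :* (R₁ :* R₀)) := (B :* A) :* (F :* (R₀ :* R₁)))
                         refl A B (frac x ω₀ ω₁) R₀ R₁) ⟩
    - ((B * A) * (frac x ω₀ ω₁ * (R₀ * R₁)))
      ≈⟨ -‿cong (*-congˡ (cross-factor x ω)) ⟨
    - pairTerm g f x ω
      ∎
    where
    ω₀ ω₁ : Fin _
    ω₀ = ω 0F
    ω₁ = ω 1F
    A B R₀ R₁ : Carrier
    A = f (x ω₁)
    B = g (x ω₀)
    R₀ = crossRow x ω ω₀
    R₁ = crossRow x ω ω₁
    ω₀≢ω₁ : ¬ ω₀ ≡ ω₁
    ω₀≢ω₁ eq with ω-inj 0F 1F eq
    ... | ()

  onInjective : ∀ {m} → ((Fin m → Fin m) → Carrier) → (Fin m → Fin m) → Carrier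
  onInjective T ω = if does (Injective? ω) then T ω else 0#

  if-dec-cong : ∀ {p q} {A : Set p} {B : Set q} (A? : Dec A) (B? : Dec B) → A ⇔ B →
                ∀ {u v} → (A → u ≈ v) → (if does A? then u else 0#) ≈ (if does B? then v else 0#)
  if-dec-cong (yes a)  (yes _)  _   u≈v = u≈v a
  if-dec-cong (yes a)  (no ¬b)  A⇔B _   = contradiction (Equivalence.to A⇔B a) ¬b
  if-dec-cong (no ¬a)  (yes b)  A⇔B _   = contradiction (Equivalence.from A⇔B b) ¬a
  if-dec-cong (no _)   (no _)   _   _   = refl

  onInjective-cong : ∀ {m} {T : (Fin m → Fin m) → Carrier} → Congruent _≗_ _≈_ T →
                     Congruent _≗_ _≈_ (onInjective T)
  onInjective-cong T-cong {ω} {ω′} ω≗ω′ = if-dec-cong (Injective? ω) (Injective? ω′)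
    (mk⇔ (≗-injective ω≗ω′) (≗-injective (≡.sym ∘ ω≗ω′))) (λ _ → T-cong ω≗ω′)

  onInjective-swap01 : ∀ f g {n} {x : Fin (2 ℕ.+ n) → Carrier} → Distinct x → ∀ ω →
    onInjective (pairTerm f g x) (ω ∘ swap01) ≈ onInjective (λ ω → - pairTerm g f x ω) ω
  onInjective-swap01 f g x-distinct ω = if-dec-cong (Injective? (ω ∘ swap01)) (Injective? ω)
    (∘swap01-injective⇔ ω) (pairTerm-swap01 f g x-distinct ∘ Equivalence.to (∘swap01-injective⇔ ω))

  symPair-antisym : ∀ f g m {x : Fin m → Carrier} → Distinct x → symPair f g m x ≈ - symPair g f m x
  symPair-antisym f g zero          _ = sym -0#≈0#
  symPair-antisym f g (suc zero)    _ = sym -0#≈0#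
  symPair-antisym f g (suc (suc n)) {x} x-distinct = begin
    K * ∑ₗ (Sym m) (pairTerm f g x)
      ≈⟨ *-congˡ (∑ₗ-filter Injective? Ω (pairTerm f g x)) ⟩
    K * ∑ₗ Ω (onInjective (pairTerm f g x))
      ≈⟨ *-congˡ (∑ₗ-allFuns-swap01 n m _ (onInjective-cong (pairTerm-cong f g x))) ⟩
    K * ∑ₗ Ω (λ ω → onInjective (pairTerm f g x) (ω ∘ swap01))
      ≈⟨ *-congˡ (∑ₗ-cong Ω (onInjective-swap01 f g x-distinct)) ⟩
    K * ∑ₗ Ω (onInjective (λ ω → - pairTerm g f x ω))
      ≈⟨ *-congˡ (∑ₗ-filter Injective? Ω (λ ω → - pairTerm g f x ω)) ⟨
    K * ∑ₗ (Sym m) (λ ω → - pairTerm g f x ω)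
      ≈⟨ *-congˡ (-‿distrib-∑ₗ (Sym m) (pairTerm g f x)) ⟨
    K * - ∑ₗ (Sym m) (pairTerm g f x)
      ≈⟨ -‿distribʳ-* K _ ⟨
    - (K * ∑ₗ (Sym m) (pairTerm g f x))
      ∎
    where
    m : ℕ
    m = 2 ℕ.+ n
    K : Carrier
    K = natCast commRing (n !) ⁻¹
    Ω : List (Fin m → Fin m)
    Ω = allFuns m m

  symPair-diag : ∀ f m {x : Fin m → Carrier} → Distinct x → symPair f f m x ≈ 0#
  symPair-diag f m x-distinct = x≈-x⇒x≈0 _ (symPair-antisym f f m x-distinct)

  symPair-bilinear : ∀ {r s} (α : Fin r → Carrier) (fs : Fin r → Carrier → Carrier)
                             (β : Fin s → Carrier) (gs : Fin s → Carrier → Carrier) {f g} →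
                     (∀ t → f t ≈ ∑[ i < r ] (α i * fs i t)) → (∀ t → g t ≈ ∑[ j < s ] (β j * gs j t)) →
                     ∀ m x → symPair f g m x ≈ ∑[ i < r ] ∑[ j < s ] ((α i * β j) * symPair (fs i) (gs j) m x)
  symPair-bilinear {r} {s} α fs β gs f≈ g≈ zero x =
    sym (sum-zero {r} λ i → sum-zero {s} λ j → zeroʳ _)
  symPair-bilinear {r} {s} α fs β gs f≈ g≈ (suc zero) x =
    sym (sum-zero {r} λ i → sum-zero {s} λ j → zeroʳ _)
  symPair-bilinear {r} {s} α fs β gs {f} {g} f≈ g≈ (suc (suc n)) x = begin
    K * ∑ₗ Ω (pairTerm f g x)
      ≈⟨ *-congˡ (∑ₗ-cong Ω expand) ⟩
    K * ∑ₗ Ω (λ ω → ∑[ i < r ] ∑[ j < s ] term i j ω)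
      ≈⟨ *-congˡ (trans (∑ₗ-sum Ω (λ i ω → ∑[ j < s ] term i j ω)) (sum-cong-≋ {r} λ i → ∑ₗ-sum Ω (term i))) ⟩
    K * ∑[ i < r ] ∑[ j < s ] ∑ₗ Ω (term i j)
      ≈⟨ *-distribˡ-sum K (λ i → ∑[ j < s ] ∑ₗ Ω (term i j)) ⟩
    ∑[ i < r ] (K * ∑[ j < s ] ∑ₗ Ω (term i j))
      ≈⟨ sum-cong-≋ {r} (λ i → trans (*-distribˡ-sum K (λ j → ∑ₗ Ω (term i j))) (sum-cong-≋ {s} (pull i))) ⟩
    ∑[ i < r ] ∑[ j < s ] ((α i * β j) * (K * ∑ₗ Ω (pairTerm (fs i) (gs j) x)))
      ∎
    where
    K : Carrier
    K = natCast commRing (n !) ⁻¹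
    Ω : List (Fin (2 ℕ.+ n) → Fin (2 ℕ.+ n))
    Ω = Sym (2 ℕ.+ n)
    term : Fin r → Fin s → (Fin (2 ℕ.+ n) → Fin (2 ℕ.+ n)) → Carrier
    term i j ω = (α i * β j) * pairTerm (fs i) (gs j) x ω
    expand : ∀ ω → pairTerm f g x ω ≈ ∑[ i < r ] ∑[ j < s ] term i j ω
    expand ω = trans (*-congʳ (*-cong (f≈ _) (g≈ _)))
      (bilinear-sum α (λ i → fs i (x (ω 0F))) β (λ j → gs j (x (ω 1F))) (cross x ω))
    pull : ∀ i j → K * ∑ₗ Ω (term i j) ≈ (α i * β j) * (K * ∑ₗ Ω (pairTerm (fs i) (gs j) x))
    pull i j = trans (*-congˡ (sym (*-distribˡ-∑ₗ (α i * β j) Ω (pairTerm (fs i) (gs j) x))))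
      (solve 3 (λ K c S → K :* (c :* S) := c :* (K :* S)) refl K (α i * β j) _)

  P2≈symPair : ∀ c {k l} → 1 ≤ k → 1 ≤ l → ∀ {m} {x : Fin m → Carrier} → Distinct x →
               P2 F c k l m x ≈ symPair (c ^↓ k) (c ^↓ l) m x
  P2≈symPair c {suc k} {suc l} _ _ {m} {x} x-distinct with suc l <? suc k | suc k <? suc l
  ... | yes _   | _       = P≈symPair c (suc k) (suc l) m x
  ... | no _    | yes _   = trans (-‿cong (P≈symPair c (suc l) (suc k) m x))
                                  (sym (symPair-antisym (c ^↓ suc k) (c ^↓ suc l) m x-distinct))
  ... | no l≮k  | no k≮l  rewrite ℕ.suc-injective (ℕ.≤-antisym (ℕ.≮⇒≥ l≮k) (ℕ.≮⇒≥ k≮l)) =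
    sym (symPair-diag (c ^↓ suc l) m x-distinct)

proposition10p1 : ∀ {c ℓ} (F : CharZeroField c ℓ) →
    let open CharZeroField F in
    (a b : ℕ → Carrier) → a 1 ≈ 0# → b 1 ≈ 0# →
    (r s : ℕ) → 1 ≤ r → 1 ≤ s →
    (m : ℕ) (x : Fin m → Carrier) → (∀ i j → x i ≈ x j → i ≡ j) →
    P2 F a r s m x
      ≈ sum1 F r (λ r′ → sum1 F s (λ s′ →
          (d F r r′ a b * d F s s′ a b) * P2 F b r′ s′ m x))
proposition10p1 F a b a₁≈0 b₁≈0 r s 1≤r 1≤s m x x-distinct = begin
  P2 F a r s m x
    ≈⟨ P2≈symPair a 1≤r 1≤s x-distinct ⟩
  symPair (a ^↓ r) (a ^↓ s) m x
    ≈⟨ symPair-bilinear {r} {s} (D r ∘ suc ∘ toℕ) b↓ (D s ∘ suc ∘ toℕ) b↓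
                                (expansion a₁≈b₁ 1≤r) (expansion a₁≈b₁ 1≤s) m x ⟩
  ∑[ i < r ] ∑[ j < s ] (δ i j * symPair (b↓ i) (b↓ j) m x)
    ≈⟨ sum-cong-≋ {r} (λ i → sum-cong-≋ {s} λ j →
         *-congˡ (P2≈symPair b {suc (toℕ i)} {suc (toℕ j)} (s≤s z≤n) (s≤s z≤n) x-distinct)) ⟨
  ∑[ i < r ] ∑[ j < s ] (δ i j * P2 F b (suc (toℕ i)) (suc (toℕ j)) m x)
    ≈⟨ sum1-sum1≈∑∑ r s (λ r′ s′ → (D r r′ * D s s′) * P2 F b r′ s′ m x) ⟨
  sum1 F r (λ r′ → sum1 F s (λ s′ → (D r r′ * D s s′) * P2 F b r′ s′ m x))
    ∎
  where
  open CharZeroField F hiding (zero)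
  open SuperComplete F
  open PairSymmetrisation F
  open RingLemmas commRing using (sum-cong-≋; sum-syntax)
  open Coefficients a b
  open import Relation.Binary.Reasoning.Setoid setoid
  a₁≈b₁ : a 1 ≈ b 1
  a₁≈b₁ = trans a₁≈0 (sym b₁≈0)
  b↓ : ∀ {n} → Fin n → Carrier → Carrier
  b↓ i = b ^↓ suc (toℕ i)
  δ : Fin r → Fin s → Carrier
  δ i j = D r (suc (toℕ i)) * D s (suc (toℕ j))
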